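{- There exists a transduction specified by an HDT0L system which is not polyregular.
   Context: An HDT0L system consists of finite alphabets $\Gamma$ (input), $\Sigma$ (output), $\Delta$ (working), an initial word $d\in\Delta^*$, monoid morphisms $h_c:\Delta^*\to\Delta^*$ for $c\in\Gamma$ and a final morphism $h':\Delta^*\to\Sigma^*$; it specifies the transduction $w_1\cdots w_n\mapsto h'\circ h_{w_1}\circ\cdots\circ h_{w_n}(d)$. Regular functions are those computed by streaming string transducers (register transducers with copyless assignments: a finite set of states with an initial state, finitely many string-valued registers, transitions $\delta:Q\times\Gamma\to Q\times((\Sigma\cup R)^*)^R$ updating registers by concatenations of output letters and old register contents such that each register is used at most once in total per update, and an output function $F:Q\to(\Sigma\cup R)^*$ using each register at most once; registers start empty, and the output is $F$ of the final state with registers replaced by their contents). For a finite alphabet $\Gamma$ with disjoint underlined copy $\underline\Gamma$, $\mathtt{squaring}_\Gamma(w_1\cdots w_n)$ is the concatenation for $i=1..n$ of $w_1\cdots w_{i-1}\underline{w_i}w_{i+1}\cdots w_n$. Polyregular functions form the smallest class closed under composition containing all regular functions and all $\mathtt{squaring}_\Gamma$. -}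

module Defs where

open import Data.Nat using (ℕ; zero; suc; _+_; _≤_)
open import Data.Fin using (Fin; _↑ˡ_; _↑ʳ_; _≟_)
open import Data.List using (List; []; _∷_; concatMap; concat; map; allFin; foldl)
open import Data.Nat.ListAction using (sum)
open import Data.Sum using (_⊎_; inj₁; inj₂)
open import Data.Product using (_×_; _,_; proj₁; proj₂; Σ; ∃)
open import Relation.Nullary using (yes; no)
open import Relation.Binary.PropositionalEquality using (_≡_)

Word : ℕ → Set
Word n = List (Fin n)

hom : ∀ {m n} → (Fin m → Word n) → Word m → Word n
hom f w = concatMap f w

record HDT0L (g s : ℕ) : Set where
  field
    k      : ℕ
    d      : Word k
    h      : Fin g → Fin k → Word k
    h'     : Fin k → Word s

hdt0lIter : ∀ {g s} → (H : HDT0L g s) → Word g → Word (HDT0L.k H)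
hdt0lIter H []      = HDT0L.d H
hdt0lIter H (c ∷ w) = hom (HDT0L.h H c) (hdt0lIter H w)

hdt0lFun : ∀ {g s} → HDT0L g s → Word g → Word s
hdt0lFun H w = hom (HDT0L.h' H) (hdt0lIter H w)

occ : ∀ {s r} → Fin r → List (Fin s ⊎ Fin r) → ℕ
occ x []            = 0
occ x (inj₁ _ ∷ e)  = occ x e
occ x (inj₂ y ∷ e) with x ≟ y
... | yes _ = suc (occ x e)
... | no  _ = occ x e

record SST (g s : ℕ) : Set where
  field
    q      : ℕ
    r      : ℕ
    init   : Fin q
    δ      : Fin q → Fin g → Fin q × (Fin r → List (Fin s ⊎ Fin r))
    F      : Fin q → List (Fin s ⊎ Fin r)
    -- copyless updates: each register used at most once in total per update
    copylessδ : ∀ p c (x : Fin r) →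
                sum (map (λ y → occ x (proj₂ (δ p c) y)) (allFin r)) ≤ 1
    copylessF : ∀ p (x : Fin r) → occ x (F p) ≤ 1

evalExpr : ∀ {s r} → (Fin r → Word s) → List (Fin s ⊎ Fin r) → Word s
evalExpr v []            = []
evalExpr v (inj₁ a ∷ e)  = a ∷ evalExpr v e
evalExpr v (inj₂ x ∷ e)  = v x Data.List.++ evalExpr v e

module _ {g s : ℕ} (T : SST g s) where
  open SST T

  Config : Set
  Config = Fin q × (Fin r → Word s)

  step : Config → Fin g → Config
  step (p , v) c = proj₁ (δ p c) , λ x → evalExpr v (proj₂ (δ p c) x)

  sstFun : Word g → Word s
  sstFun w with foldl step (init , λ _ → []) w
  ... | (p , v) = evalExpr v (F p)

-- squaring over Γ = Fin a; Γ ∪ underline(Γ) = Fin (a + a),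
-- plain letters via _↑ˡ_ (first a), underlined letters via _↑ʳ_ (last a).

plain : ∀ {a} → Fin a → Fin (a + a)
plain {a} c = c ↑ˡ a

under : ∀ {a} → Fin a → Fin (a + a)
under {a} c = a ↑ʳ c

-- the list, for i = 1..n, of w₁⋯w_{i-1} underline(wᵢ) w_{i+1}⋯wₙ
marks : ∀ {a} → Word a → List (Word (a + a))
marks []      = []
marks (c ∷ w) = (under c ∷ map plain w) ∷ map (plain c ∷_) (marks w)

squaring : ∀ {a} → Word a → Word (a + a)
squaring w = concat (marks w)

-- Polyregular functions: smallest class containing regular functions and
-- squaring, closed under composition (intermediate alphabets arbitrary).

data PolyTerm : ℕ → ℕ → Set where
  reg  : ∀ {a b} → SST a b → PolyTerm a b
  sq   : (a : ℕ) → PolyTerm a (a + a)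
  comp : ∀ {a b c} → PolyTerm b c → PolyTerm a b → PolyTerm a c

⟦_⟧ : ∀ {a b} → PolyTerm a b → Word a → Word b
⟦ reg T ⟧    = sstFun T
⟦ sq a ⟧     = squaring
⟦ comp t u ⟧ = λ w → ⟦ t ⟧ (⟦ u ⟧ w)

Polyregular : ∀ {a b} → (Word a → Word b) → Set
Polyregular {a} {b} f = Σ (PolyTerm a b) (λ t → ∀ w → ⟦ t ⟧ w ≡ f w)

-- Polyregular functions have polynomially bounded output length. A copyless update
-- moves each old register into at most one new register, so the total size of the
-- registers of a streaming string transducer grows by at most a constant per input
-- letter; squaring is quadratic; and polynomial bounds compose. The HDT0L system whose
-- single working letter is doubled by every input letter outputs 2ⁿ letters on inputs
-- of length n, which outgrows every polynomial.
module Submission where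

open import Defs
open import Data.Nat using (ℕ; zero; suc; pred; _+_; _*_; _^_; _≤_; _<_; z≤n; s≤s; s≤s⁻¹; ≢-nonZero)
open import Data.Nat.Properties hiding (_≟_)
open import Data.Nat.Tactic.RingSolver using (solve)
import Data.Nat.ListAction as ListAction
open import Data.Fin using (Fin; zero; suc; _≟_)
open import Data.List using (List; []; _∷_; length; map; concat; replicate; foldl; tabulate; allFin; _++_)
open import Data.List.Properties using (length-++; length-map; length-replicate; map-tabulate)
open import Data.Sum using (_⊎_; inj₁; inj₂)
open import Data.Product using (Σ; ∃; ∃₂; _,_; proj₂)
open import Function using (_∘_; id)
open import Relation.Nullary using (¬_; yes; no; contradiction)
open import Relation.Binary.PropositionalEquality using (_≡_; _≗_; refl; sym; trans; cong; cong₂; subst)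
open import Algebra.Properties.Semiring.Sum +-*-semiring
  using (sum-syntax; sum-cong-≗; sum-remove; sum-replicate-zero; ∑-distrib-+; ∑-comm; *-distribʳ-sum)
import Algebra.Properties.CommutativeSemigroup as CommutativeSemigroupProperties
open CommutativeSemigroupProperties +-commutativeSemigroup using (x∙yz≈y∙xz; x∙yz≈yx∙z)
open CommutativeSemigroupProperties *-commutativeSemigroup using (interchange)
open ≤-Reasoning

PolynomiallyBounded : ∀ {a b} → (Word a → Word b) → Set
PolynomiallyBounded f = ∃₂ λ C k → ∀ w → length (f w) ≤ C * (length w + 1) ^ k

polynomiallyBounded-≗ : ∀ {a b} {f g : Word a → Word b} →
                        f ≗ g → PolynomiallyBounded f → PolynomiallyBounded g
polynomiallyBounded-≗ f≗g (C , k , bound) =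
  C , k , λ w → subst (λ u → length u ≤ C * (length w + 1) ^ k) (f≗g w) (bound w)

1≤[n+1]^k : ∀ n k → 1 ≤ (n + 1) ^ k
1≤[n+1]^k n = m^n>0 (n + 1) {{≢-nonZero (m+1+n≢0 n)}}

^-distribʳ-* : ∀ m n k → (m * n) ^ k ≡ m ^ k * n ^ k
^-distribʳ-* m n zero    = refl
^-distribʳ-* m n (suc k) = trans (cong (m * n *_) (^-distribʳ-* m n k)) (interchange m n (m ^ k) (n ^ k))

polynomiallyBounded-∘ : ∀ {a b c} {f : Word b → Word c} {g : Word a → Word b} →
                        PolynomiallyBounded f → PolynomiallyBounded g → PolynomiallyBounded (f ∘ g)
polynomiallyBounded-∘ {f = f} {g} (C₁ , k₁ , f≤) (C₂ , k₂ , g≤) =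
  C₁ * (1 + C₂) ^ k₁ , k₂ * k₁ , λ w → let P = (length w + 1) ^ k₂ in begin
    length (f (g w))                   ≤⟨ f≤ (g w) ⟩
    C₁ * (length (g w) + 1) ^ k₁       ≤⟨ *-monoʳ-≤ C₁ (^-monoˡ-≤ k₁ (+-monoˡ-≤ 1 (g≤ w))) ⟩
    C₁ * (C₂ * P + 1) ^ k₁             ≤⟨ *-monoʳ-≤ C₁ (^-monoˡ-≤ k₁ (affine≤ C₂ (1≤[n+1]^k (length w) k₂))) ⟩
    C₁ * ((1 + C₂) * P) ^ k₁           ≡⟨ cong (C₁ *_) (^-distribʳ-* (1 + C₂) P k₁) ⟩
    C₁ * ((1 + C₂) ^ k₁ * P ^ k₁)      ≡⟨ *-assoc C₁ _ _ ⟨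
    C₁ * (1 + C₂) ^ k₁ * P ^ k₁        ≡⟨ cong (C₁ * (1 + C₂) ^ k₁ *_) (^-*-assoc (length w + 1) k₂ k₁) ⟩
    C₁ * (1 + C₂) ^ k₁ * (length w + 1) ^ (k₂ * k₁) ∎
  where
  affine≤ : ∀ C {P} → 1 ≤ P → C * P + 1 ≤ (1 + C) * P
  affine≤ C {P} 1≤P = ≤-trans (≤-reflexive (+-comm (C * P) 1)) (+-monoˡ-≤ (C * P) 1≤P)

sum-tabulate : ∀ {n} (f : Fin n → ℕ) → ListAction.sum (tabulate f) ≡ ∑[ i < n ] f i
sum-tabulate {zero}  f = refl
sum-tabulate {suc n} f = cong (f zero +_) (sum-tabulate (f ∘ suc))

sum-allFin : ∀ {n} (f : Fin n → ℕ) → ListAction.sum (map f (allFin n)) ≡ ∑[ i < n ] f i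
sum-allFin f = trans (cong ListAction.sum (map-tabulate id f)) (sum-tabulate f)

∑-mono-≤ : ∀ {n} {f g : Fin n → ℕ} → (∀ i → f i ≤ g i) → ∑[ i < n ] f i ≤ ∑[ i < n ] g i
∑-mono-≤ {zero}  f≤g = z≤n
∑-mono-≤ {suc n} f≤g = +-mono-≤ (f≤g zero) (∑-mono-≤ (f≤g ∘ suc))

term≤∑ : ∀ {n} (f : Fin n → ℕ) i → f i ≤ ∑[ j < n ] f j
term≤∑ {suc n} f i = ≤-trans (m≤m+n (f i) _) (≤-reflexive (sym (sum-remove {i = i} f)))

RegExpr : ℕ → ℕ → Set
RegExpr s r = List (Fin s ⊎ Fin r)

literals : ∀ {s r} → RegExpr s r → ℕ
literals []           = 0
literals (inj₁ _ ∷ e) = suc (literals e)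
literals (inj₂ _ ∷ e) = literals e

module _ {s r : ℕ} where

  registerSize : (Fin r → Word s) → ℕ
  registerSize v = ∑[ y < r ] length (v y)

  registerPart : (Fin r → Word s) → RegExpr s r → ℕ
  registerPart v e = ∑[ y < r ] (occ y e * length (v y))

  occ-inj₂ : ∀ y x (e : RegExpr s r) → occ y (inj₂ x ∷ e) ≡ occ {s} y (inj₂ x ∷ []) + occ y e
  occ-inj₂ y x e with y ≟ x
  ... | yes _ = refl
  ... | no  _ = refl

  occ-self : ∀ (x : Fin r) → occ {s} x (inj₂ x ∷ []) ≡ 1
  occ-self x with x ≟ x
  ... | yes _   = refl
  ... | no  x≢x = contradiction refl x≢x

  registerPart-inj₂ : ∀ v x (e : RegExpr s r) →
                      length (v x) + registerPart v e ≤ registerPart v (inj₂ x ∷ e)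
  registerPart-inj₂ v x e = begin
    L x + registerPart v e
      ≡⟨ cong (_+ registerPart v e) (*-identityˡ (L x)) ⟨
    1 * L x + registerPart v e
      ≡⟨ cong (λ m → m * L x + registerPart v e) (occ-self x) ⟨
    occ x [x] * L x + registerPart v e
      ≤⟨ +-monoˡ-≤ (registerPart v e) (term≤∑ (λ y → occ y [x] * L y) x) ⟩
    ∑[ y < r ] (occ y [x] * L y) + registerPart v e
      ≡⟨ ∑-distrib-+ (λ y → occ y [x] * L y) (λ y → occ y e * L y) ⟨
    ∑[ y < r ] (occ y [x] * L y + occ y e * L y)
      ≡⟨ sum-cong-≗ split ⟩
    registerPart v (inj₂ x ∷ e) ∎
    where
    L : Fin r → ℕ
    L y = length (v y)
    [x] : RegExpr s r
    [x] = inj₂ x ∷ []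
    split : ∀ y → occ y [x] * L y + occ y e * L y ≡ occ y (inj₂ x ∷ e) * L y
    split y = trans (sym (*-distribʳ-+ (L y) (occ y [x]) (occ y e))) (cong (_* L y) (sym (occ-inj₂ y x e)))

  length-evalExpr : ∀ v (e : RegExpr s r) → length (evalExpr v e) ≤ literals e + registerPart v e
  length-evalExpr v []           = z≤n
  length-evalExpr v (inj₁ _ ∷ e) = s≤s (length-evalExpr v e)
  length-evalExpr v (inj₂ x ∷ e) = begin
    length (v x ++ evalExpr v e)                     ≡⟨ length-++ (v x) ⟩
    length (v x) + length (evalExpr v e)             ≤⟨ +-monoʳ-≤ (length (v x)) (length-evalExpr v e) ⟩
    length (v x) + (literals e + registerPart v e)   ≡⟨ x∙yz≈y∙xz (length (v x)) (literals e) _ ⟩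
    literals e + (length (v x) + registerPart v e)   ≤⟨ +-monoʳ-≤ (literals e) (registerPart-inj₂ v x e) ⟩
    literals e + registerPart v (inj₂ x ∷ e)         ∎

  weighted≤registerSize : ∀ v (m : Fin r → ℕ) → (∀ y → m y ≤ 1) →
                          ∑[ y < r ] (m y * length (v y)) ≤ registerSize v
  weighted≤registerSize v m m≤1 =
    ∑-mono-≤ (λ y → ≤-trans (*-monoˡ-≤ (length (v y)) (m≤1 y)) (≤-reflexive (*-identityˡ (length (v y)))))

  length-evalExpr-copyless : ∀ v (e : RegExpr s r) → (∀ y → occ y e ≤ 1) →
                             length (evalExpr v e) ≤ literals e + registerSize v
  length-evalExpr-copyless v e once = ≤-trans (length-evalExpr v e)
    (+-monoʳ-≤ (literals e) (weighted≤registerSize v (λ y → occ y e) once))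

  registerSize-copylessUpdate : ∀ v (e : Fin r → RegExpr s r) → (∀ y → ∑[ x < r ] occ y (e x) ≤ 1) →
    registerSize (λ x → evalExpr v (e x)) ≤ ∑[ x < r ] literals (e x) + registerSize v
  registerSize-copylessUpdate v e once = begin
    ∑[ x < r ] length (evalExpr v (e x))
      ≤⟨ ∑-mono-≤ (λ x → length-evalExpr v (e x)) ⟩
    ∑[ x < r ] (literals (e x) + registerPart v (e x))
      ≡⟨ ∑-distrib-+ (literals ∘ e) (registerPart v ∘ e) ⟩
    Λ + ∑[ x < r ] ∑[ y < r ] (occ y (e x) * L y)
      ≡⟨ cong (Λ +_) (∑-comm (λ x y → occ y (e x) * L y)) ⟩
    Λ + ∑[ y < r ] ∑[ x < r ] (occ y (e x) * L y)
      ≡⟨ cong (Λ +_) (sum-cong-≗ (λ y → *-distribʳ-sum (L y) (λ x → occ y (e x)))) ⟨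
    Λ + ∑[ y < r ] ((∑[ x < r ] occ y (e x)) * L y)
      ≤⟨ +-monoʳ-≤ Λ (weighted≤registerSize v _ once) ⟩
    Λ + registerSize v ∎
    where
    L : Fin r → ℕ
    L y = length (v y)
    Λ : ℕ
    Λ = ∑[ x < r ] literals (e x)

module _ {g s : ℕ} (T : SST g s) where
  open SST T

  updateLiteralsAt : Fin q → Fin g → ℕ
  updateLiteralsAt p c = ∑[ x < r ] literals (proj₂ (δ p c) x)

  updateLiterals : ℕ
  updateLiterals = ∑[ p < q ] ∑[ c < g ] updateLiteralsAt p c

  outputLiterals : ℕ
  outputLiterals = ∑[ p < q ] literals (F p)

  registerSize-step : ∀ p c v → registerSize (proj₂ (step T (p , v) c)) ≤ updateLiterals + registerSize v
  registerSize-step p c v = ≤-trans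
    (registerSize-copylessUpdate v (proj₂ (δ p c)) copyless)
    (+-monoˡ-≤ (registerSize v)
      (≤-trans (term≤∑ (updateLiteralsAt p) c) (term≤∑ (λ p → ∑[ c < g ] updateLiteralsAt p c) p)))
    where
    copyless : ∀ y → ∑[ x < r ] occ y (proj₂ (δ p c) x) ≤ 1
    copyless y = subst (_≤ 1) (sum-allFin (λ x → occ y (proj₂ (δ p c) x))) (copylessδ p c y)

  registerSize-run : ∀ w (cfg : Config T) →
    registerSize (proj₂ (foldl (step T) cfg w)) ≤ length w * updateLiterals + registerSize (proj₂ cfg)
  registerSize-run []      cfg     = ≤-refl
  registerSize-run (c ∷ w) (p , v) = begin
    registerSize (proj₂ (foldl (step T) (step T (p , v) c) w))
      ≤⟨ registerSize-run w (step T (p , v) c) ⟩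
    length w * updateLiterals + registerSize (proj₂ (step T (p , v) c))
      ≤⟨ +-monoʳ-≤ (length w * updateLiterals) (registerSize-step p c v) ⟩
    length w * updateLiterals + (updateLiterals + registerSize v)
      ≡⟨ x∙yz≈yx∙z (length w * updateLiterals) updateLiterals (registerSize v) ⟩
    suc (length w) * updateLiterals + registerSize v ∎

  length-sstFun : ∀ w → length (sstFun T w) ≤ outputLiterals + length w * updateLiterals
  length-sstFun w with foldl (step T) (init , λ _ → []) w | registerSize-run w (init , λ _ → [])
  ... | p , v | run = begin
    length (evalExpr v (F p))
      ≤⟨ length-evalExpr-copyless v (F p) (copylessF p) ⟩
    literals (F p) + registerSize v
      ≤⟨ +-mono-≤ (term≤∑ (λ p → literals (F p)) p) run ⟩
    outputLiterals + (length w * updateLiterals + registerSize {s} {r} (λ _ → []))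
      ≡⟨ cong (λ m → outputLiterals + (length w * updateLiterals + m)) (sum-replicate-zero r) ⟩
    outputLiterals + (length w * updateLiterals + 0)
      ≡⟨ cong (outputLiterals +_) (+-identityʳ (length w * updateLiterals)) ⟩
    outputLiterals + length w * updateLiterals ∎

sstFun-polynomiallyBounded : ∀ {g s} (T : SST g s) → PolynomiallyBounded (sstFun T)
sstFun-polynomiallyBounded T = outputLiterals T + updateLiterals T , 1 , λ w →
  ≤-trans (length-sstFun T w) (linear≤ (outputLiterals T) (updateLiterals T) (length w))
  where
  linear≤ : ∀ O U n → O + n * U ≤ (O + U) * (n + 1) ^ 1
  linear≤ O U n = begin
    O + n * U                   ≤⟨ m≤m+n (O + n * U) (U + n * O) ⟩
    O + n * U + (U + n * O)     ≡⟨ solve (O ∷ U ∷ n ∷ []) ⟨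
    (O + U) * (n + 1)           ≡⟨ cong ((O + U) *_) (*-identityʳ (n + 1)) ⟨
    (O + U) * (n + 1) ^ 1       ∎

length-concat-map-∷ : ∀ {A : Set} (x : A) (xss : List (List A)) →
                      length (concat (map (x ∷_) xss)) ≡ length xss + length (concat xss)
length-concat-map-∷ x []         = refl
length-concat-map-∷ x (xs ∷ xss) = begin-equality
  length (x ∷ xs ++ concat (map (x ∷_) xss))
    ≡⟨ cong suc (length-++ xs) ⟩
  suc (length xs + length (concat (map (x ∷_) xss)))
    ≡⟨ cong (λ m → suc (length xs + m)) (length-concat-map-∷ x xss) ⟩
  suc (length xs + (length xss + length (concat xss)))
    ≡⟨ cong suc (x∙yz≈y∙xz (length xs) (length xss) _) ⟩
  suc (length xss + (length xs + length (concat xss)))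
    ≡⟨ cong (λ m → suc (length xss + m)) (length-++ xs) ⟨
  length (xs ∷ xss) + length (concat (xs ∷ xss)) ∎

length-marks : ∀ {a} (w : Word a) → length (marks w) ≡ length w
length-marks []      = refl
length-marks (c ∷ w) = cong suc (trans (length-map _ (marks w)) (length-marks w))

length-squaring : ∀ {a} (w : Word a) → length (squaring w) ≡ length w * length w
length-squaring []      = refl
length-squaring (c ∷ w) = begin-equality
  length ((under c ∷ map plain w) ++ concat (map (plain c ∷_) (marks w)))
    ≡⟨ cong suc (length-++ (map plain w)) ⟩
  suc (length (map plain w) + length (concat (map (plain c ∷_) (marks w))))
    ≡⟨ cong (λ m → suc (length (map plain w) + m)) (length-concat-map-∷ (plain c) (marks w)) ⟩
  suc (length (map plain w) + (length (marks w) + length (squaring w)))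
    ≡⟨ cong₂ (λ m k → suc (m + k)) (length-map plain w) (cong₂ _+_ (length-marks w) (length-squaring w)) ⟩
  suc (n + (n + n * n))
    ≡⟨ cong suc (cong (n +_) (*-suc n n)) ⟨
  suc n * suc n ∎
  where
  n = length w

squaring-polynomiallyBounded : ∀ a → PolynomiallyBounded (squaring {a})
squaring-polynomiallyBounded a = 1 , 2 , λ w → let n = length w in begin
  length (squaring w)       ≡⟨ length-squaring w ⟩
  n * n                     ≤⟨ *-mono-≤ (m≤m+n n 1) (m≤m+n n 1) ⟩
  (n + 1) * (n + 1)         ≡⟨ cong ((n + 1) *_) (*-identityʳ (n + 1)) ⟨
  (n + 1) ^ 2               ≡⟨ *-identityˡ ((n + 1) ^ 2) ⟨
  1 * (n + 1) ^ 2           ∎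

⟦⟧-polynomiallyBounded : ∀ {a b} (t : PolyTerm a b) → PolynomiallyBounded ⟦ t ⟧
⟦⟧-polynomiallyBounded (reg T)    = sstFun-polynomiallyBounded T
⟦⟧-polynomiallyBounded (sq a)     = squaring-polynomiallyBounded a
⟦⟧-polynomiallyBounded (comp t u) =
  polynomiallyBounded-∘ {f = ⟦ t ⟧} {g = ⟦ u ⟧} (⟦⟧-polynomiallyBounded t) (⟦⟧-polynomiallyBounded u)

polyregular⇒polynomiallyBounded : ∀ {a b} {f : Word a → Word b} → Polyregular f → PolynomiallyBounded f
polyregular⇒polynomiallyBounded (t , ⟦t⟧≗f) = polynomiallyBounded-≗ ⟦t⟧≗f (⟦⟧-polynomiallyBounded t)

n<2^n : ∀ n → n < 2 ^ n
n<2^n zero    = s≤s z≤n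
n<2^n (suc n) = begin-strict
  suc n           <⟨ s≤s (n<2^n n) ⟩
  suc (2 ^ n)     ≤⟨ +-monoˡ-≤ (2 ^ n) (m^n>0 2 n) ⟩
  2 ^ n + 2 ^ n   ≡⟨ cong (2 ^ n +_) (+-identityʳ (2 ^ n)) ⟨
  2 ^ suc n       ∎

linear<exponential : ∀ a b → ∃ λ M → a * M + b < 2 ^ M
linear<exponential a b = m + m , (begin-strict
  a * (m + m) + b     ≡⟨ cong (_+ b) (*-distribˡ-+ a m m) ⟩
  a * m + a * m + b   ≡⟨ cong (_+ b) (*-distribʳ-+ m a a) ⟨
  (a + a) * m + b     ≤⟨ +-mono-≤ (*-monoˡ-≤ m (m≤m+n (a + a) b)) (m≤n+m b (a + a)) ⟩
  m * m + m           ≡⟨ +-comm (m * m) m ⟩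
  m + m * m           <⟨ s≤s (+-monoʳ-≤ m (*-monoʳ-≤ m (n≤1+n m))) ⟩
  suc m * suc m       ≤⟨ *-mono-≤ (n<2^n m) (n<2^n m) ⟩
  2 ^ m * 2 ^ m       ≡⟨ ^-distribˡ-+-* 2 m m ⟨
  2 ^ (m + m)         ∎)
  where
  m = a + a + b

-- Taking n + 1 = 2^M reduces C (n + 1)^k < 2^n to the linear bound k M + C < 2^M.
exponential-beats-polynomial : ∀ C k → ∃ λ n → C * (n + 1) ^ k < 2 ^ n
exponential-beats-polynomial C k with linear<exponential k C
... | M , kM+C<2^M = n , (begin-strict
  C * (n + 1) ^ k       ≡⟨ cong (λ m → C * m ^ k) n+1≡2^M ⟩
  C * (2 ^ M) ^ k       ≡⟨ cong (C *_) (^-*-assoc 2 M k) ⟩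
  C * 2 ^ (M * k)       <⟨ *-monoˡ-< (2 ^ (M * k)) {{m^n≢0 2 (M * k)}} (n<2^n C) ⟩
  2 ^ C * 2 ^ (M * k)   ≡⟨ ^-distribˡ-+-* 2 C (M * k) ⟨
  2 ^ (C + M * k)       ≤⟨ ^-monoʳ-≤ 2 (s≤s⁻¹ C+Mk<1+n) ⟩
  2 ^ n                 ∎)
  where
  n = pred (2 ^ M)
  1+n≡2^M : suc n ≡ 2 ^ M
  1+n≡2^M = suc-pred (2 ^ M) {{m^n≢0 2 M}}
  n+1≡2^M : n + 1 ≡ 2 ^ M
  n+1≡2^M = trans (+-comm n 1) 1+n≡2^M
  C+Mk<1+n : C + M * k < suc n
  C+Mk<1+n = begin-strict
    C + M * k   ≡⟨ +-comm C (M * k) ⟩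
    M * k + C   ≡⟨ cong (_+ C) (*-comm M k) ⟩
    k * M + C   <⟨ kM+C<2^M ⟩
    2 ^ M       ≡⟨ 1+n≡2^M ⟨
    suc n       ∎

length-hom-uniform : ∀ {m n ℓ} {f : Fin m → Word n} → (∀ x → length (f x) ≡ ℓ) →
                     ∀ w → length (hom f w) ≡ ℓ * length w
length-hom-uniform {ℓ = ℓ} {f} f≡ℓ []      = sym (*-zeroʳ ℓ)
length-hom-uniform {ℓ = ℓ} {f} f≡ℓ (x ∷ w) = begin-equality
  length (f x ++ hom f w)            ≡⟨ length-++ (f x) ⟩
  length (f x) + length (hom f w)    ≡⟨ cong₂ _+_ (f≡ℓ x) (length-hom-uniform f≡ℓ w) ⟩
  ℓ + ℓ * length w                   ≡⟨ *-suc ℓ (length w) ⟨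
  ℓ * suc (length w)                 ∎

doubling : HDT0L 1 1
doubling = record { k = 1 ; d = zero ∷ [] ; h = λ _ x → x ∷ x ∷ [] ; h' = λ x → x ∷ [] }

length-hdt0lIter-doubling : ∀ w → length (hdt0lIter doubling w) ≡ 2 ^ length w
length-hdt0lIter-doubling []      = refl
length-hdt0lIter-doubling (c ∷ w) =
  trans (length-hom-uniform (λ _ → refl) (hdt0lIter doubling w)) (cong (2 *_) (length-hdt0lIter-doubling w))

length-hdt0lFun-doubling : ∀ w → length (hdt0lFun doubling w) ≡ 2 ^ length w
length-hdt0lFun-doubling w = begin-equality
  length (hdt0lFun doubling w)        ≡⟨ length-hom-uniform (λ _ → refl) (hdt0lIter doubling w) ⟩
  1 * length (hdt0lIter doubling w)   ≡⟨ *-identityˡ _ ⟩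
  length (hdt0lIter doubling w)       ≡⟨ length-hdt0lIter-doubling w ⟩
  2 ^ length w                        ∎

exponential-not-polynomiallyBounded : ∀ {a b} {f : Word (suc a) → Word b} →
  (∀ w → length (f w) ≡ 2 ^ length w) → ¬ PolynomiallyBounded f
exponential-not-polynomiallyBounded {f = f} length≡2^ (C , k , bound)
  with exponential-beats-polynomial C k
... | n , poly<exp = <⇒≱ poly<exp (begin
  2 ^ n                    ≡⟨ cong (2 ^_) (length-replicate n) ⟨
  2 ^ length w             ≡⟨ length≡2^ w ⟨
  length (f w)             ≤⟨ bound w ⟩
  C * (length w + 1) ^ k   ≡⟨ cong (λ m → C * (m + 1) ^ k) (length-replicate n) ⟩
  C * (n + 1) ^ k          ∎)
  where
  w = replicate n zero

proposition21 : Σ ℕ (λ g → Σ ℕ (λ s → Σ (HDT0L g s) (λ H → ¬ Polyregular (hdt0lFun H))))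
proposition21 = 1 , 1 , doubling ,
  exponential-not-polynomiallyBounded {f = hdt0lFun doubling} length-hdt0lFun-doubling
  ∘ polyregular⇒polynomiallyBounded
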